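{- We have $i^*(n)\geq 0$ for $n\in\{3,4\}$; $i^*(n)\geq 1$ for $n\in\{5,6\}$; $i^*(n)\geq 3$ for $n\in\{7,8\}$; $i^*(n)\geq 4$ for $n\in\{9,10\}$; $i^*(n)\geq 7$ for $n\in\{11,12\}$; $i^*(n)\geq n-2$ for odd $n\geq 13$; and $i^*(n)\geq n-3$ for even $n\geq 14$. In particular $i^*(n)\geq f(n-2)$ for all $n\geq 3$, where $f(t)=0$ for $t\leq 2$, $f(t)=1$ for $t\in\{3,4\}$, $f(t)=3$ for $t\in\{5,6\}$, $f(t)=4$ for $t\in\{7,8\}$, $f(t)=7$ for $t\in\{9,10\}$, and $f(t)=t-1$ for $t\geq 11$.
   Context: For a positive integer $n$, an $n$-starter is a graph $G$ on $n$ vertices whose complement $\overline G$ is a forest with $\lceil (n-2)/2\rceil$ edges. For a graph $H$, $e(H)$ is its number of edges and $L(H)$ its line graph. $i^*(n)$ is the largest integer such that for every $i\in\{0,1,\dots,i^*(n)\}$ there exists an $n$-starter $G$ with $e(L(\overline G))=i$. -}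

module Defs where

open import Data.Bool using (Bool; true; false; not; _∨_; if_then_else_)
open import Data.Bool.Properties using (∨-comm)
open import Data.Nat using (ℕ; zero; suc; _≤_; _<?_; _∸_; ⌈_/2⌉)
open import Data.Fin using (Fin; toℕ; _≟_)
open import Data.List using (List; []; _∷_; length; filter; concatMap; map; allFin; lookup)
open import Data.List.Relation.Unary.Unique.Propositional using (Unique)
open import Data.Product using (Σ; _×_; _,_; ∃; proj₁; proj₂)
open import Data.Unit using (⊤)
open import Relation.Nullary using (¬_; does)
open import Relation.Binary.PropositionalEquality using (_≡_; refl; sym)

record Graph (n : ℕ) : Set where
  field
    adj    : Fin n → Fin n → Bool
    adj-sym    : ∀ i j → adj i j ≡ adj j i
    adj-irrefl : ∀ i → adj i i ≡ false
open Graph public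

symClos : ∀ {m} → (Fin m → Fin m → Bool) → Fin m → Fin m → Bool
symClos r i j = if does (i ≟ j) then false else (r i j ∨ r j i)

symClos-sym : ∀ {m} (r : Fin m → Fin m → Bool) i j → symClos r i j ≡ symClos r j i
symClos-sym r i j with i ≟ j | j ≟ i
... | Relation.Nullary.yes _ | Relation.Nullary.yes _ = refl
... | Relation.Nullary.yes refl | Relation.Nullary.no ¬p = Data.Empty.⊥-elim (¬p refl)
  where import Data.Empty
... | Relation.Nullary.no ¬p | Relation.Nullary.yes refl = Data.Empty.⊥-elim (¬p refl)
  where import Data.Empty
... | Relation.Nullary.no _ | Relation.Nullary.no _ = ∨-comm (r i j) (r j i)

symClos-irrefl : ∀ {m} (r : Fin m → Fin m → Bool) i → symClos r i i ≡ false
symClos-irrefl r i with i ≟ i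
... | Relation.Nullary.yes _ = refl
... | Relation.Nullary.no ¬p = Data.Empty.⊥-elim (¬p refl)
  where import Data.Empty

mkGraph : ∀ {m} → (Fin m → Fin m → Bool) → Graph m
mkGraph r = record { adj = symClos r ; adj-sym = symClos-sym r ; adj-irrefl = symClos-irrefl r }

complement : ∀ {n} → Graph n → Graph n
complement G = mkGraph (λ i j → not (adj G i j))

edges : ∀ {n} → Graph n → List (Fin n × Fin n)
edges {n} G = filter (λ p → adjDec p) (concatMap (λ i → map (λ j → (i , j)) (allFin n)) (allFin n))
  where
  open import Relation.Nullary using (Dec; yes; no)
  adjDec : (p : Fin n × Fin n) → Dec ((toℕ (proj₁ p) Data.Nat.< toℕ (proj₂ p)) × (adj G (proj₁ p) (proj₂ p) ≡ true))
  adjDec (i , j) with toℕ i <? toℕ j | adj G i j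
  ... | yes p | true  = yes (p , refl)
  ... | yes p | false = no (λ { (_ , ()) })
  ... | no ¬p | _     = no (λ q → ¬p (proj₁ q))

e : ∀ {n} → Graph n → ℕ
e G = length (edges G)

_∈ₑ_ : ∀ {n} → Fin n → Fin n × Fin n → Bool
v ∈ₑ (a , b) = does (v ≟ a) ∨ does (v ≟ b)

meets : ∀ {n} → Fin n × Fin n → Fin n × Fin n → Bool
meets (a , b) q = (a ∈ₑ q) ∨ (b ∈ₑ q)

L : ∀ {n} (G : Graph n) → Graph (e G)
L G = mkGraph (λ k l → meets (lookup (edges G) k) (lookup (edges G) l))

Chain : ∀ {n} → Graph n → List (Fin n) → Set
Chain G []           = ⊤
Chain G (x ∷ [])     = ⊤
Chain G (x ∷ y ∷ r)  = (adj G x y ≡ true) × Chain G (y ∷ r)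

lastOr : ∀ {A : Set} → A → List A → A
lastOr a []       = a
lastOr a (b ∷ bs) = lastOr b bs

HasCycle : ∀ {n} → Graph n → Set
HasCycle {n} G = Σ (Fin n) λ x → Σ (List (Fin n)) λ vs →
  (2 ≤ length vs) × Unique (x ∷ vs) × Chain G (x ∷ vs) × (adj G (lastOr x vs) x ≡ true)

Forest : ∀ {n} → Graph n → Set
Forest G = ¬ HasCycle G

Starter : (n : ℕ) → Graph n → Set
Starter n G = Forest (complement G) × (e (complement G) ≡ ⌈ n ∸ 2 /2⌉)

-- "i*(n) ≥ k": every i ∈ {0,…,k} is realised as e(L(complement G)) by some n-starter G.
IStarAtLeast : ℕ → ℕ → Set
IStarAtLeast n k = ∀ i → i ≤ k → Σ (Graph n) λ G → Starter n G × (e (L (complement G)) ≡ i)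

f : ℕ → ℕ
f 0  = 0
f 1  = 0
f 2  = 0
f 3  = 1
f 4  = 1
f 5  = 3
f 6  = 3
f 7  = 4
f 8  = 4
f 9  = 7
f 10 = 7
f t  = t ∸ 1

-- An n-starter is the complement of a forest F with ⌈(n−2)/2⌉ edges, and e(L(F)) counts the pairs
-- of edges of F that share a vertex. So it suffices to find, for each i, a tree with i such pairs and
-- few edges, and to pad it with disjoint edges and isolated vertices, which create no new pairs.
-- For i ≤ 9 the trees are listed explicitly. For i ≥ 10 they grow from six seed trees by hanging
-- three pendant vertices on a leaf, which adds 3 edges and 6 pairs; hence a tree with i pairs and
-- at most (i + 2)/2 edges exists, and it fits the edge budget ⌈(n−2)/2⌉ whenever i < 2⌈(n−2)/2⌉
-- and that budget is at least 6, i.e. for n ≥ 13.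

module Submission where

open import Defs
open import Data.Bool using (Bool; true; false; not; _∨_; _∧_; T; if_then_else_)
open import Data.Bool.Properties using (T-∧; T-≡; ∨-idem)
open import Data.Nat using (ℕ; zero; suc; _+_; _*_; _∸_; _%_; _/_; _<ᵇ_; _≤_; _<_; _≤?_; _<?_; z≤n; s≤s; ⌊_/2⌋; ⌈_/2⌉)
open import Data.Nat.Properties
  using (<ᵇ⇒<; <⇒<ᵇ; ≤ᵇ⇒≤; +-assoc; +-identityʳ; ≤-refl; ≤-trans; ≤-pred; <⇒≤; m≤m+n; ∸-monoʳ-≤; ≮⇒≥; n≤1+n; m≤n⇒m≤1+n; m+[n∸m]≡n; m≤n⇒∃[o]m+o≡n)
open import Data.Nat.DivMod using (m≡m%n+[m/n]*n; m%n<n)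
open import Data.Nat.Solver using (module +-*-Solver)
open import Data.Fin using (Fin; toℕ; _≟_; _↑ˡ_; #_; fromℕ<) renaming (zero to fz; suc to fs)
open import Data.Fin.Properties using (all?; toℕ-fromℕ<)
open import Data.List using (List; []; _∷_; _++_; _∷ʳ_; [_]; length; map; concat; concatMap; filterᵇ; allFin; lookup; fromMaybe)
open import Data.List.Properties using (filter-≐; filter-++; length-++; length-map; map-tabulate; tabulate-lookup; map-∘; ++-assoc; filter-none; ++-identityʳ; concat-map; concatMap-cong)
open import Data.List.Membership.Propositional using (_∈_)
import Data.List.Membership.DecPropositional as DecMembership
open import Data.List.Relation.Unary.Any using (here; there)
open import Data.List.Relation.Unary.All as All using (All; []; _∷_)
open import Data.List.Relation.Unary.All.Properties as All using (¬Any⇒All¬)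
open import Data.List.Relation.Unary.AllPairs using ([]; _∷_)
import Data.List.Relation.Unary.AllPairs.Properties as AllPairs
open import Data.List.Relation.Unary.Unique.Propositional using (Unique)
import Data.List.Relation.Unary.Unique.Propositional.Properties as Unique
open import Data.Empty using (⊥-elim)
open import Data.Maybe as Maybe using (Maybe; just; nothing)
open import Data.Unit using (tt)
open import Data.Product using (Σ; ∃; _×_; _,_; proj₁; proj₂)
open import Data.Sum using (_⊎_; inj₁; inj₂)
open import Function using (_∘_; Equivalence)
open import Relation.Nullary using (¬_; does; yes; no)
open import Relation.Nullary.Decidable using (T?; True; toWitness)
open import Relation.Binary.PropositionalEquality using (_≡_; refl; sym; trans; cong; cong₂; subst; module ≡-Reasoning)

open +-*-Solver

count : ∀ {A : Set} → (A → Bool) → List A → ℕ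
count b = length ∘ filterᵇ b

filterᵇ-cong : ∀ {A : Set} {b c : A → Bool} → (∀ x → b x ≡ c x) → ∀ xs → filterᵇ b xs ≡ filterᵇ c xs
filterᵇ-cong {b = b} {c} b≗c = filter-≐ (T? ∘ b) (T? ∘ c) ((λ {x} → subst T (b≗c x)) , (λ {x} → subst T (sym (b≗c x))))

filterᵇ-map : ∀ {A B : Set} (b : B → Bool) (f : A → B) xs → filterᵇ b (map f xs) ≡ map f (filterᵇ (b ∘ f) xs)
filterᵇ-map b f [] = refl
filterᵇ-map b f (x ∷ xs) with b (f x)
... | true  = cong (f x ∷_) (filterᵇ-map b f xs)
... | false = filterᵇ-map b f xs

filterᵇ-concatMap : ∀ {A B : Set} (b : B → Bool) (f : A → List B) xs →
  filterᵇ b (concatMap f xs) ≡ concatMap (filterᵇ b ∘ f) xs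
filterᵇ-concatMap b f [] = refl
filterᵇ-concatMap b f (x ∷ xs) =
  trans (filter-++ (T? ∘ b) (f x) _) (cong (filterᵇ b (f x) ++_) (filterᵇ-concatMap b f xs))

concatMap-map-map : ∀ {A B C : Set} (f : B → C) (g : A → List B) xs →
  concatMap (map f ∘ g) xs ≡ map f (concatMap g xs)
concatMap-map-map f g xs = trans (cong concat (map-∘ xs)) (concat-map (map g xs))

count-++ : ∀ {A : Set} (b : A → Bool) xs ys → count b (xs ++ ys) ≡ count b xs + count b ys
count-++ b xs ys = trans (cong length (filter-++ (T? ∘ b) xs ys)) (length-++ (filterᵇ b xs))

count-map : ∀ {A B : Set} (b : B → Bool) (f : A → B) xs → count b (map f xs) ≡ count (b ∘ f) xs
count-map b f xs = trans (cong length (filterᵇ-map b f xs)) (length-map f (filterᵇ (b ∘ f) xs))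

count-[_] : ∀ {A : Set} {b : A → Bool} x → count b [ x ] ≡ (if b x then 1 else 0)
count-[_] {b = b} x with b x
... | true  = refl
... | false = refl

count-false : ∀ {A : Set} (xs : List A) → count (λ _ → false) xs ≡ 0
count-false []       = refl
count-false (x ∷ xs) = count-false xs

allFin-suc : ∀ n → allFin (suc n) ≡ fz ∷ map fs (allFin n)
allFin-suc n = cong (fz ∷_) (sym (map-tabulate (λ i → i) fs))

count-lookup : ∀ {A : Set} (g : A → Bool) (ℓ : List A) → count (g ∘ lookup ℓ) (allFin (length ℓ)) ≡ count g ℓ
count-lookup g ℓ = begin
  length (filterᵇ (g ∘ lookup ℓ) A)              ≡⟨ sym (length-map (lookup ℓ) (filterᵇ (g ∘ lookup ℓ) A)) ⟩
  length (map (lookup ℓ) (filterᵇ (g ∘ lookup ℓ) A)) ≡⟨ cong length (sym (filterᵇ-map g (lookup ℓ) A)) ⟩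
  length (filterᵇ g (map (lookup ℓ) A))          ≡⟨ cong (count g) (trans (map-tabulate (λ i → i) (lookup ℓ)) (tabulate-lookup ℓ)) ⟩
  length (filterᵇ g ℓ) ∎
  where
  open ≡-Reasoning
  A = allFin (length ℓ)

does-≟-sym : ∀ {n} (i j : Fin n) → does (i ≟ j) ≡ does (j ≟ i)
does-≟-sym fz     fz     = refl
does-≟-sym fz     (fs j) = refl
does-≟-sym (fs i) fz     = refl
does-≟-sym (fs i) (fs j) = does-≟-sym i j

BoolRel : ℕ → Set
BoolRel n = Fin n → Fin n → Bool

pairs : (n : ℕ) → List (Fin n × Fin n)
pairs n = concatMap (λ i → map (λ j → (i , j)) (allFin n)) (allFin n)

isEdge : ∀ {n} → BoolRel n → Fin n × Fin n → Bool
isEdge r (i , j) = (toℕ i <ᵇ toℕ j) ∧ r i j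

edgeList : ∀ {n} → BoolRel n → List (Fin n × Fin n)
edgeList {n} r = filterᵇ (isEdge r) (pairs n)

edges≡edgeList : ∀ {n} (G : Graph n) → edges G ≡ edgeList (adj G)
edges≡edgeList {n} G = filter-≐ _ _ (to , from) (pairs n)
  where
  to : ∀ {p} → (toℕ (proj₁ p) < toℕ (proj₂ p)) × (adj G (proj₁ p) (proj₂ p) ≡ true) → T (isEdge (adj G) p)
  to (i<j , ij) = Equivalence.from T-∧ (<⇒<ᵇ i<j , Equivalence.from T-≡ ij)
  from : ∀ {p} → T (isEdge (adj G) p) → (toℕ (proj₁ p) < toℕ (proj₂ p)) × (adj G (proj₁ p) (proj₂ p) ≡ true)
  from {i , j} t with Equivalence.to T-∧ t
  ... | i<j , ij = <ᵇ⇒< (toℕ i) (toℕ j) i<j , Equivalence.to T-≡ ij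

edgeList-cong : ∀ {n} {r s : BoolRel n} → (∀ i j → r i j ≡ s i j) → edgeList r ≡ edgeList s
edgeList-cong {n} r≗s = filterᵇ-cong (λ { (i , j) → cong ((toℕ i <ᵇ toℕ j) ∧_) (r≗s i j) }) (pairs n)

edges-cong : ∀ {n} {G H : Graph n} → (∀ i j → adj G i j ≡ adj H i j) → edges G ≡ edges H
edges-cong {G = G} {H} G≗H = trans (edges≡edgeList G) (trans (edgeList-cong G≗H) (sym (edges≡edgeList H)))

fromZero : ∀ {n} → Fin n → Fin (suc n) × Fin (suc n)
fromZero j = (fz , fs j)

shift : ∀ {n} → Fin n × Fin n → Fin (suc n) × Fin (suc n)
shift (i , j) = (fs i , fs j)

restrict : ∀ {n} → BoolRel (suc n) → BoolRel n
restrict r i j = r (fs i) (fs j)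

edgeList-suc : ∀ {n} (r : BoolRel (suc n)) →
  edgeList r ≡ map fromZero (filterᵇ (r fz ∘ fs) (allFin n)) ++ map shift (edgeList (restrict r))
edgeList-suc {n} r = begin
  filterᵇ (isEdge r) (concatMap row (allFin (suc n)))
    ≡⟨ cong (filterᵇ (isEdge r) ∘ concatMap row) (allFin-suc n) ⟩
  filterᵇ (isEdge r) (row fz ++ concatMap row (map fs A))
    ≡⟨ filter-++ (T? ∘ isEdge r) (row fz) _ ⟩
  filterᵇ (isEdge r) (row fz) ++ filterᵇ (isEdge r) (concatMap row (map fs A))
    ≡⟨ cong₂ _++_ (trans (cong (filterᵇ (isEdge r)) (row-suc fz)) (filterᵇ-map (isEdge r) _ A)) rest ⟩
  map fromZero (filterᵇ (r fz ∘ fs) A) ++ map shift (edgeList (restrict r)) ∎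
  where
  open ≡-Reasoning
  A = allFin n
  row : Fin (suc n) → List (Fin (suc n) × Fin (suc n))
  row i = map (i ,_) (allFin (suc n))
  row-suc : ∀ i → row i ≡ (i , fz) ∷ map (λ j → (i , fs j)) A
  row-suc i = trans (cong (map (i ,_)) (allFin-suc n)) (cong ((i , fz) ∷_) (sym (map-∘ A)))
  restrictRow : ∀ i → filterᵇ (isEdge r) (row (fs i)) ≡ map shift (filterᵇ (isEdge (restrict r)) (map (i ,_) A))
  restrictRow i = begin
    filterᵇ (isEdge r) (row (fs i))                    ≡⟨ cong (filterᵇ (isEdge r)) (row-suc (fs i)) ⟩
    filterᵇ (isEdge r) (map (shift ∘ (i ,_)) A)        ≡⟨ filterᵇ-map (isEdge r) _ A ⟩
    map (shift ∘ (i ,_)) (filterᵇ (isEdge (restrict r) ∘ (i ,_)) A) ≡⟨ map-∘ _ ⟩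
    map shift (map (i ,_) (filterᵇ (isEdge (restrict r) ∘ (i ,_)) A)) ≡⟨ cong (map shift) (sym (filterᵇ-map _ _ A)) ⟩
    map shift (filterᵇ (isEdge (restrict r)) (map (i ,_) A)) ∎
  rest : filterᵇ (isEdge r) (concatMap row (map fs A)) ≡ map shift (edgeList (restrict r))
  rest = begin
    filterᵇ (isEdge r) (concatMap row (map fs A))      ≡⟨ cong (filterᵇ (isEdge r) ∘ concat) (sym (map-∘ A)) ⟩
    filterᵇ (isEdge r) (concatMap (row ∘ fs) A)        ≡⟨ filterᵇ-concatMap (isEdge r) _ A ⟩
    concatMap (filterᵇ (isEdge r) ∘ row ∘ fs) A        ≡⟨ concatMap-cong restrictRow A ⟩
    concatMap (map shift ∘ λ i → filterᵇ (isEdge (restrict r)) (map (i ,_) A)) A ≡⟨ concatMap-map-map shift _ A ⟩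
    map shift (concatMap (λ i → filterᵇ (isEdge (restrict r)) (map (i ,_) A)) A) ≡⟨ cong (map shift) (sym (filterᵇ-concatMap _ _ A)) ⟩
    map shift (edgeList (restrict r)) ∎

length-edgeList-suc : ∀ {n} (r : BoolRel (suc n)) →
  length (edgeList r) ≡ count (r fz ∘ fs) (allFin n) + length (edgeList (restrict r))
length-edgeList-suc {n} r = begin
  length (edgeList r)                             ≡⟨ cong length (edgeList-suc r) ⟩
  length (map fromZero (filterᵇ (r fz ∘ fs) (allFin n)) ++ map shift (edgeList (restrict r)))
                                                  ≡⟨ length-++ (map fromZero (filterᵇ (r fz ∘ fs) (allFin n))) {map shift (edgeList (restrict r))} ⟩
  length (map fromZero (filterᵇ (r fz ∘ fs) (allFin n))) + length (map shift (edgeList (restrict r)))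
                                                  ≡⟨ cong₂ _+_ (length-map fromZero (filterᵇ (r fz ∘ fs) (allFin n))) (length-map shift (edgeList (restrict r))) ⟩
  count (r fz ∘ fs) (allFin n) + length (edgeList (restrict r)) ∎
  where open ≡-Reasoning

touches : ∀ {n} → Fin n × Fin n → Fin n × Fin n → Bool
touches p q = meets p q ∨ meets q p

touchingPairs : ∀ {n} → List (Fin n × Fin n) → ℕ
touchingPairs []       = 0
touchingPairs (p ∷ ps) = count (touches p) ps + touchingPairs ps

e-L : ∀ {n} (X : Graph n) → e (L X) ≡ touchingPairs (edges X)
e-L X = trans (cong length (edges≡edgeList (L X))) (lineGraphEdges (edges X))
  where
  lineGraphEdges : ∀ ℓ → length (edgeList (symClos (λ k l → meets (lookup ℓ k) (lookup ℓ l)))) ≡ touchingPairs ℓ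
  lineGraphEdges []      = refl
  lineGraphEdges (p ∷ ℓ) =
    trans (length-edgeList-suc (symClos (λ k l → meets (lookup (p ∷ ℓ) k) (lookup (p ∷ ℓ) l)))) (cong₂ _+_ (count-lookup (touches p) ℓ) (lineGraphEdges ℓ))

adj-complement-complement : ∀ {n} (G : Graph n) i j → adj (complement (complement G)) i j ≡ adj G i j
adj-complement-complement G i j with i ≟ j | j ≟ i
... | yes refl | _        = sym (adj-irrefl G i)
... | no i≢j   | yes refl = ⊥-elim (i≢j refl)
... | no _     | no _     rewrite adj-sym G j i = not-not-or (adj G i j)
  where
  not-not-or : ∀ a → not (not a ∨ not a) ∨ not (not a ∨ not a) ≡ a
  not-not-or true  = refl
  not-not-or false = refl

IsCycle : ∀ {n} → Graph n → Fin n → List (Fin n) → Set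
IsCycle G x vs = (2 ≤ length vs) × Unique (x ∷ vs) × Chain G (x ∷ vs) × (adj G (lastOr x vs) x ≡ true)

Chain-cong : ∀ {n} {G H : Graph n} → (∀ i j → adj G i j ≡ adj H i j) → ∀ xs → Chain G xs → Chain H xs
Chain-cong G≗H []          _          = tt
Chain-cong G≗H (x ∷ [])    _          = tt
Chain-cong G≗H (x ∷ y ∷ r) (xy , ch) = trans (sym (G≗H x y)) xy , Chain-cong G≗H (y ∷ r) ch

Forest-cong : ∀ {n} {G H : Graph n} → (∀ i j → adj G i j ≡ adj H i j) → Forest H → Forest G
Forest-cong G≗H forest (x , vs , len , uniq , ch , close) =
  forest (x , vs , len , uniq , Chain-cong G≗H (x ∷ vs) ch , trans (sym (G≗H _ x)) close)

lastOr-∈ : ∀ {A : Set} (v : A) vs → lastOr v vs ∈ v ∷ vs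
lastOr-∈ v []       = here refl
lastOr-∈ v (w ∷ ws) = there (lastOr-∈ w ws)

lastOr-∷ʳ : ∀ {A : Set} (v : A) vs x → lastOr v (vs ∷ʳ x) ≡ x
lastOr-∷ʳ v []       x = refl
lastOr-∷ʳ v (w ∷ ws) x = lastOr-∷ʳ w ws x

lastOr-map : ∀ {A B : Set} (f : A → B) v vs → lastOr (f v) (map f vs) ≡ f (lastOr v vs)
lastOr-map f v []       = refl
lastOr-map f v (w ∷ ws) = lastOr-map f w ws

Chain-∷ʳ : ∀ {n} (G : Graph n) v vs y → Chain G (v ∷ vs) → adj G (lastOr v vs) y ≡ true → Chain G (v ∷ vs ∷ʳ y)
Chain-∷ʳ G v []       y _         vy = vy , tt
Chain-∷ʳ G v (w ∷ ws) y (vw , ch) wy = vw , Chain-∷ʳ G w ws y ch wy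

IsCycle-rotate : ∀ {n} (G : Graph n) x v vs → IsCycle G x (v ∷ vs) → IsCycle G v (vs ∷ʳ x)
IsCycle-rotate G x v vs (len , ((x≢v ∷ x∉vs) ∷ (v∉vs ∷ uniq)) , (xv , ch) , close) =
  length-∷ʳ vs len ,
  All.∷ʳ⁺ v∉vs (x≢v ∘ sym) ∷ AllPairs.++⁺ uniq ([] ∷ []) (All.map (λ x≢w → (x≢w ∘ sym) ∷ []) x∉vs) ,
  Chain-∷ʳ G v vs x ch close ,
  subst (λ z → adj G z v ≡ true) (sym (lastOr-∷ʳ v vs x)) xv
  where
  length-∷ʳ : ∀ vs → 2 ≤ suc (length vs) → 2 ≤ length (vs ∷ʳ x)
  length-∷ʳ []          (s≤s ())
  length-∷ʳ (_ ∷ [])    _ = s≤s (s≤s z≤n)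
  length-∷ʳ (_ ∷ _ ∷ _) _ = s≤s (s≤s z≤n)

IsCycle-rotateTo : ∀ {n} (G : Graph n) {y} x as bs → y ∈ x ∷ as → IsCycle G x (as ++ bs) → ∃ (IsCycle G y)
IsCycle-rotateTo G x as       bs (here refl) cyc = as ++ bs , cyc
IsCycle-rotateTo G x (a ∷ as) bs (there y∈)  cyc =
  IsCycle-rotateTo G a as (bs ∷ʳ x) y∈ (subst (IsCycle G a) (++-assoc as bs [ x ]) (IsCycle-rotate G x a (as ++ bs) cyc))

AtMostOneNeighbour : ∀ {n} → Graph n → Fin n → Set
AtMostOneNeighbour G y = ∀ {u w} → adj G y u ≡ true → adj G y w ≡ true → u ≡ w

-- A cycle leaves its first vertex along two different edges.
AtMostOneNeighbour⇒¬IsCycle : ∀ {n} (G : Graph n) {y} → AtMostOneNeighbour G y → ∀ vs → ¬ IsCycle G y vs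
AtMostOneNeighbour⇒¬IsCycle G lone (v ∷ w ∷ ws) (_ , (_ ∷ (v∉ ∷ _)) , (yv , _) , close) =
  All.lookup v∉ (lastOr-∈ w ws) (lone yv (trans (adj-sym G _ _) close))
AtMostOneNeighbour⇒¬IsCycle G lone (v ∷ []) (s≤s () , _)

deleteZero : ∀ {n} → Graph (suc n) → Graph n
deleteZero G = record
  { adj        = restrict (adj G)
  ; adj-sym    = λ i j → adj-sym G (fs i) (fs j)
  ; adj-irrefl = λ i → adj-irrefl G (fs i)
  }

avoidsZero⇒map-suc : ∀ {n} (xs : List (Fin (suc n))) → All (λ z → ¬ fz ≡ z) xs → ∃ λ ys → xs ≡ map fs ys
avoidsZero⇒map-suc []        []          = [] , refl
avoidsZero⇒map-suc (fz ∷ _)  (fz≢ ∷ _)   = ⊥-elim (fz≢ refl)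
avoidsZero⇒map-suc (fs x ∷ xs) (_ ∷ avoid) with avoidsZero⇒map-suc xs avoid
... | ys , refl = x ∷ ys , refl

Chain-deleteZero : ∀ {n} (G : Graph (suc n)) xs → Chain G (map fs xs) → Chain (deleteZero G) xs
Chain-deleteZero G []          _         = tt
Chain-deleteZero G (x ∷ [])    _         = tt
Chain-deleteZero G (x ∷ y ∷ r) (xy , ch) = xy , Chain-deleteZero G (y ∷ r) ch

IsCycle-deleteZero : ∀ {n} (G : Graph (suc n)) x vs → IsCycle G (fs x) (map fs vs) → IsCycle (deleteZero G) x vs
IsCycle-deleteZero G x vs (len , uniq , ch , close) =
  subst (2 ≤_) (length-map fs vs) len ,
  Unique.map⁻ uniq ,
  Chain-deleteZero G (x ∷ vs) ch ,
  subst (λ z → adj G z (fs x) ≡ true) (lastOr-map fs x vs) close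

Forest-deleteZero : ∀ {n} (G : Graph (suc n)) → AtMostOneNeighbour G fz → Forest (deleteZero G) → Forest G
Forest-deleteZero G lone forest (x , vs , cyc) with DecMembership._∈?_ _≟_ fz (x ∷ vs)
... | yes fz∈ = let ws , cyc′ = IsCycle-rotateTo G x vs [] fz∈ (subst (IsCycle G x) (sym (++-identityʳ vs)) cyc)
                in AtMostOneNeighbour⇒¬IsCycle G lone ws cyc′
... | no fz∉ with avoidsZero⇒map-suc (x ∷ vs) (¬Any⇒All¬ (x ∷ vs) fz∉)
...   | x′ ∷ vs′ , refl = forest (x′ , vs′ , IsCycle-deleteZero G x′ vs′ cyc)

-- Forests given by parent vectors

-- Vertex 0 of `p ∷ ps` is joined to its parent p, if any, which is a vertex of ps;
-- so every vertex has at most one neighbour among the vertices after it.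
data Parents : ℕ → Set where
  []  : Parents 0
  _∷_ : ∀ {n} → Maybe (Fin n) → Parents n → Parents (suc n)

isParent : ∀ {n} → Maybe (Fin n) → Fin n → Bool
isParent nothing  j = false
isParent (just k) j = does (j ≟ k)

parentAdj : ∀ {n} → Parents n → BoolRel n
parentAdj (p ∷ ps) fz     fz     = false
parentAdj (p ∷ ps) fz     (fs j) = isParent p j
parentAdj (p ∷ ps) (fs i) fz     = isParent p i
parentAdj (p ∷ ps) (fs i) (fs j) = parentAdj ps i j

parentGraph : ∀ {n} → Parents n → Graph n
parentGraph ps = record { adj = parentAdj ps ; adj-sym = sym′ ps ; adj-irrefl = irrefl ps }
  where
  sym′ : ∀ {n} (ps : Parents n) i j → parentAdj ps i j ≡ parentAdj ps j i
  sym′ (p ∷ ps) fz     fz     = refl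
  sym′ (p ∷ ps) fz     (fs j) = refl
  sym′ (p ∷ ps) (fs i) fz     = refl
  sym′ (p ∷ ps) (fs i) (fs j) = sym′ ps i j
  irrefl : ∀ {n} (ps : Parents n) i → parentAdj ps i i ≡ false
  irrefl (p ∷ ps) fz     = refl
  irrefl (p ∷ ps) (fs i) = irrefl ps i

Forest-parentGraph : ∀ {n} (ps : Parents n) → Forest (parentGraph ps)
Forest-parentGraph []       (() , _)
Forest-parentGraph (p ∷ ps) =
  Forest-deleteZero (parentGraph (p ∷ ps)) (lone p) (Forest-cong (λ _ _ → refl) (Forest-parentGraph ps))
  where
  lone : ∀ {n} (p : Maybe (Fin n)) {ps : Parents n} → AtMostOneNeighbour (parentGraph (p ∷ ps)) fz
  lone (just k) {u = fs i} {w = fs j} ik jk = cong fs (trans (does-≟⇒≡ ik) (sym (does-≟⇒≡ jk)))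
    where
    does-≟⇒≡ : ∀ {i} → does (i ≟ k) ≡ true → i ≡ k
    does-≟⇒≡ {i} eq with i ≟ k | eq
    ... | yes i≡k | _ = i≡k

edgeCount : ∀ {n} → Parents n → ℕ
edgeCount []             = 0
edgeCount (nothing ∷ ps) = edgeCount ps
edgeCount (just _ ∷ ps)  = suc (edgeCount ps)

degree : ∀ {n} → Parents n → Fin n → ℕ
degree (nothing ∷ ps) fz     = 0
degree (just _ ∷ ps)  fz     = 1
degree (p ∷ ps)       (fs j) = (if isParent p j then 1 else 0) + degree ps j

-- The edge from vertex 0 to its parent k touches exactly the edges of ps at k.
lineEdgeCount : ∀ {n} → Parents n → ℕ
lineEdgeCount []             = 0
lineEdgeCount (nothing ∷ ps) = lineEdgeCount ps
lineEdgeCount (just k ∷ ps)  = degree ps k + lineEdgeCount ps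

filterᵇ-isParent : ∀ {n} (p : Maybe (Fin n)) → filterᵇ (isParent p) (allFin n) ≡ fromMaybe p
filterᵇ-isParent {n} nothing = filter-none (T? ∘ isParent nothing) (All.universal (λ _ ()) (allFin n))
filterᵇ-isParent {suc n} (just k) = begin
  filterᵇ (isParent (just k)) (allFin (suc n))            ≡⟨ cong (filterᵇ (isParent (just k))) (allFin-suc n) ⟩
  filterᵇ (isParent (just k)) (fz ∷ map fs (allFin n))    ≡⟨ atZero k ⟩
  [ k ] ∎
  where
  open ≡-Reasoning
  atZero : ∀ k → filterᵇ (isParent (just k)) (fz ∷ map fs (allFin n)) ≡ [ k ]
  atZero fz     = cong (fz ∷_) (trans (filterᵇ-map _ fs (allFin n)) (cong (map fs) (filterᵇ-isParent nothing)))
  atZero (fs k) = trans (filterᵇ-map _ fs (allFin n)) (cong (map fs) (filterᵇ-isParent (just k)))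

edgeList-parents : ∀ {n} (p : Maybe (Fin n)) ps →
  edgeList (parentAdj (p ∷ ps)) ≡ map fromZero (fromMaybe p) ++ map shift (edgeList (parentAdj ps))
edgeList-parents p ps =
  trans (edgeList-suc (parentAdj (p ∷ ps))) (cong (λ zs → map fromZero zs ++ _) (filterᵇ-isParent p))

length-edgeList-parents : ∀ {n} (ps : Parents n) → length (edgeList (parentAdj ps)) ≡ edgeCount ps
length-edgeList-parents []       = refl
length-edgeList-parents (p ∷ ps) = begin
  length (edgeList (parentAdj (p ∷ ps)))     ≡⟨ cong length (edgeList-parents p ps) ⟩
  length (map fromZero (fromMaybe p) ++ map shift E) ≡⟨ length-++ (map fromZero (fromMaybe p)) ⟩
  length (map fromZero (fromMaybe p)) + length (map shift E)
    ≡⟨ cong (length (map fromZero (fromMaybe p)) +_) (trans (length-map shift E) (length-edgeList-parents ps)) ⟩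
  length (map fromZero (fromMaybe p)) + edgeCount ps ≡⟨ headEdge p ⟩
  edgeCount (p ∷ ps) ∎
  where
  open ≡-Reasoning
  E = edgeList (parentAdj ps)
  headEdge : ∀ p → length (map fromZero (fromMaybe p)) + edgeCount ps ≡ edgeCount (p ∷ ps)
  headEdge nothing  = refl
  headEdge (just _) = refl

count-edgeList-parents : ∀ {n} (ps : Parents n) v → count (v ∈ₑ_) (edgeList (parentAdj ps)) ≡ degree ps v
count-edgeList-parents (p ∷ ps) v = begin
  count (v ∈ₑ_) (edgeList (parentAdj (p ∷ ps)))     ≡⟨ cong (count (v ∈ₑ_)) (edgeList-parents p ps) ⟩
  count (v ∈ₑ_) (map fromZero (fromMaybe p) ++ map shift E)
    ≡⟨ count-++ (v ∈ₑ_) (map fromZero (fromMaybe p)) (map shift E) ⟩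
  count (v ∈ₑ_) (map fromZero (fromMaybe p)) + count (v ∈ₑ_) (map shift E)
    ≡⟨ cong (count (v ∈ₑ_) (map fromZero (fromMaybe p)) +_) (count-map (v ∈ₑ_) shift E) ⟩
  count (v ∈ₑ_) (map fromZero (fromMaybe p)) + count ((v ∈ₑ_) ∘ shift) E ≡⟨ split p v ⟩
  degree (p ∷ ps) v ∎
  where
  open ≡-Reasoning
  E = edgeList (parentAdj ps)
  split : ∀ p v → count (v ∈ₑ_) (map fromZero (fromMaybe p)) + count ((v ∈ₑ_) ∘ shift) E ≡ degree (p ∷ ps) v
  split nothing  fz     = count-false E
  split (just k) fz     = cong suc (count-false E)
  split nothing  (fs v) = count-edgeList-parents ps v
  split (just k) (fs v) = cong₂ _+_ (count-[_] {b = fs v ∈ₑ_} (fromZero k)) (count-edgeList-parents ps v)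

touchingPairs-map-shift : ∀ {n} (B : List (Fin n × Fin n)) → touchingPairs (map shift B) ≡ touchingPairs B
touchingPairs-map-shift []      = refl
touchingPairs-map-shift (q ∷ B) = cong₂ _+_ (count-map (touches (shift q)) shift B) (touchingPairs-map-shift B)

touches-fromZero-shift : ∀ {n} (k : Fin n) q → touches (fromZero k) (shift q) ≡ k ∈ₑ q
touches-fromZero-shift k (a , b) rewrite does-≟-sym a k | does-≟-sym b k = ∨-idem (k ∈ₑ (a , b))

touchingPairs-edgeList-parents : ∀ {n} (ps : Parents n) → touchingPairs (edgeList (parentAdj ps)) ≡ lineEdgeCount ps
touchingPairs-edgeList-parents []       = refl
touchingPairs-edgeList-parents (p ∷ ps) =
  trans (cong touchingPairs (edgeList-parents p ps)) (headPairs p)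
  where
  open ≡-Reasoning
  E = edgeList (parentAdj ps)
  rest : touchingPairs (map shift E) ≡ lineEdgeCount ps
  rest = trans (touchingPairs-map-shift E) (touchingPairs-edgeList-parents ps)
  headPairs : ∀ p → touchingPairs (map fromZero (fromMaybe p) ++ map shift E) ≡ lineEdgeCount (p ∷ ps)
  headPairs nothing  = rest
  headPairs (just k) = cong₂ _+_ (begin
    count (touches (fromZero k)) (map shift E) ≡⟨ count-map _ shift E ⟩
    count (touches (fromZero k) ∘ shift) E     ≡⟨ cong length (filterᵇ-cong (touches-fromZero-shift k) E) ⟩
    count (k ∈ₑ_) E                            ≡⟨ count-edgeList-parents ps k ⟩
    degree ps k ∎) rest

infixr 5 _++ᵖ_
_++ᵖ_ : ∀ {m n} → Parents m → Parents n → Parents (m + n)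
[]       ++ᵖ qs = qs
_++ᵖ_ {n = n} (p ∷ ps) qs = Maybe.map (_↑ˡ n) p ∷ (ps ++ᵖ qs)

edgeCount-++ᵖ : ∀ {m n} (ps : Parents m) (qs : Parents n) → edgeCount (ps ++ᵖ qs) ≡ edgeCount ps + edgeCount qs
edgeCount-++ᵖ []             qs = refl
edgeCount-++ᵖ (nothing ∷ ps) qs = edgeCount-++ᵖ ps qs
edgeCount-++ᵖ (just _ ∷ ps)  qs = cong suc (edgeCount-++ᵖ ps qs)

does-↑ˡ-≟ : ∀ {m} n (i j : Fin m) → does (i ↑ˡ n ≟ j ↑ˡ n) ≡ does (i ≟ j)
does-↑ˡ-≟ n fz     fz     = refl
does-↑ˡ-≟ n fz     (fs j) = refl
does-↑ˡ-≟ n (fs i) fz     = refl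
does-↑ˡ-≟ n (fs i) (fs j) = does-↑ˡ-≟ n i j

degree-++ᵖ : ∀ {m n} (ps : Parents m) (qs : Parents n) k → degree (ps ++ᵖ qs) (k ↑ˡ n) ≡ degree ps k
degree-++ᵖ (nothing ∷ ps) qs fz     = refl
degree-++ᵖ (just _ ∷ ps)  qs fz     = refl
degree-++ᵖ (nothing ∷ ps) qs (fs k) = degree-++ᵖ ps qs k
degree-++ᵖ {n = n} (just j ∷ ps) qs (fs k) =
  cong₂ _+_ (cong (λ b → if b then 1 else 0) (does-↑ˡ-≟ n k j)) (degree-++ᵖ ps qs k)

lineEdgeCount-++ᵖ : ∀ {m n} (ps : Parents m) (qs : Parents n) →
  lineEdgeCount (ps ++ᵖ qs) ≡ lineEdgeCount ps + lineEdgeCount qs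
lineEdgeCount-++ᵖ []             qs = refl
lineEdgeCount-++ᵖ (nothing ∷ ps) qs = lineEdgeCount-++ᵖ ps qs
lineEdgeCount-++ᵖ (just k ∷ ps)  qs = begin
  degree (ps ++ᵖ qs) (k ↑ˡ _) + lineEdgeCount (ps ++ᵖ qs)
    ≡⟨ cong₂ _+_ (degree-++ᵖ ps qs k) (lineEdgeCount-++ᵖ ps qs) ⟩
  degree ps k + (lineEdgeCount ps + lineEdgeCount qs)
    ≡⟨ sym (+-assoc (degree ps k) _ _) ⟩
  degree ps k + lineEdgeCount ps + lineEdgeCount qs ∎
  where open ≡-Reasoning

matching : (d : ℕ) → Parents (d * 2)
matching zero    = []
matching (suc d) = just fz ∷ nothing ∷ matching d

edgeCount-matching : ∀ d → edgeCount (matching d) ≡ d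
edgeCount-matching zero    = refl
edgeCount-matching (suc d) = cong suc (edgeCount-matching d)

lineEdgeCount-matching : ∀ d → lineEdgeCount (matching d) ≡ 0
lineEdgeCount-matching zero    = refl
lineEdgeCount-matching (suc d) = lineEdgeCount-matching d

isolated : (q : ℕ) → Parents q
isolated zero    = []
isolated (suc q) = nothing ∷ isolated q

edgeCount-isolated : ∀ q → edgeCount (isolated q) ≡ 0
edgeCount-isolated zero    = refl
edgeCount-isolated (suc q) = edgeCount-isolated q

lineEdgeCount-isolated : ∀ q → lineEdgeCount (isolated q) ≡ 0
lineEdgeCount-isolated zero    = refl
lineEdgeCount-isolated (suc q) = lineEdgeCount-isolated q

Realisable : ℕ → ℕ → Set
Realisable n i = Σ (Graph n) λ G → Starter n G × (e (L (complement G)) ≡ i)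

Parents⇒Realisable : ∀ {n} (ps : Parents n) → edgeCount ps ≡ ⌈ n ∸ 2 /2⌉ → Realisable n (lineEdgeCount ps)
Parents⇒Realisable {n} ps edges≡ = complement F , (forest , edgeBudget) , lineSize
  where
  F F̄̄ : Graph n
  F   = parentGraph ps
  F̄̄ = complement (complement F)
  edges-F̄̄ : edges F̄̄ ≡ edgeList (parentAdj ps)
  edges-F̄̄ = trans (edges-cong {G = F̄̄} {H = F} (adj-complement-complement F)) (edges≡edgeList F)
  forest : Forest F̄̄
  forest = Forest-cong (adj-complement-complement F) (Forest-parentGraph ps)
  edgeBudget : e F̄̄ ≡ ⌈ n ∸ 2 /2⌉
  edgeBudget = trans (cong length edges-F̄̄) (trans (length-edgeList-parents ps) edges≡)
  lineSize : e (L F̄̄) ≡ lineEdgeCount ps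
  lineSize = trans (e-L F̄̄) (trans (cong touchingPairs edges-F̄̄) (touchingPairs-edgeList-parents ps))

-- Trees with a prescribed number of line-graph edges

record Tree (lineEdges : ℕ) : Set where
  field
    size           : ℕ
    parents        : Parents (suc size)
    edgeCount≡size : edgeCount parents ≡ size
    lineEdgeCount≡ : lineEdgeCount parents ≡ lineEdges
open Tree

mkTree : ∀ {size} (ps : Parents (suc size)) → edgeCount ps ≡ size → Tree (lineEdgeCount ps)
mkTree ps e = record { parents = ps ; edgeCount≡size = e ; lineEdgeCount≡ = refl }

to : ∀ k {n} {k<n : True (k <? n)} → Maybe (Fin n)
to k {k<n = k<n} = just (#_ k {m<n = k<n})

claw : ∀ {n} → Parents (suc n) → Parents (3 + suc n)
claw ps = to 2 ∷ to 1 ∷ to 0 ∷ ps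

-- Three pendant vertices raise the degree of a leaf from 1 to 4, i.e. C(4,2) = 6 more touching pairs.
lineEdgeCount-claw : ∀ {n} (ps : Parents (suc n)) → degree ps fz ≡ 1 → lineEdgeCount (claw ps) ≡ 6 + lineEdgeCount ps
lineEdgeCount-claw ps leaf rewrite leaf = refl

clawTree : ∀ {i} (T : Tree i) → degree (parents T) fz ≡ 1 → Tree (6 + i)
clawTree T leaf = record
  { parents        = claw (parents T)
  ; edgeCount≡size = cong (3 +_) (edgeCount≡size T)
  ; lineEdgeCount≡ = trans (lineEdgeCount-claw (parents T) leaf) (cong (6 +_) (lineEdgeCount≡ T))
  }

largeTree : ∀ k → Tree (10 + k)
largeTree-leaf : ∀ k → degree (parents (largeTree k)) fz ≡ 1

largeTree 0 = mkTree (to 4 ∷ to 3 ∷ to 2 ∷ to 1 ∷ to 0 ∷ nothing ∷ []) refl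
largeTree 1 = mkTree (to 0 ∷ to 4 ∷ to 3 ∷ to 2 ∷ to 1 ∷ to 0 ∷ nothing ∷ []) refl
largeTree 2 = mkTree (to 0 ∷ to 0 ∷ to 4 ∷ to 3 ∷ to 2 ∷ to 1 ∷ to 0 ∷ nothing ∷ []) refl
largeTree 3 = mkTree (to 1 ∷ to 0 ∷ to 4 ∷ to 3 ∷ to 2 ∷ to 1 ∷ to 0 ∷ nothing ∷ []) refl
largeTree 4 = mkTree (to 1 ∷ to 0 ∷ to 0 ∷ to 4 ∷ to 3 ∷ to 2 ∷ to 1 ∷ to 0 ∷ nothing ∷ []) refl
largeTree 5 = mkTree (to 5 ∷ to 4 ∷ to 3 ∷ to 2 ∷ to 1 ∷ to 0 ∷ nothing ∷ []) refl
largeTree (suc (suc (suc (suc (suc (suc k)))))) = clawTree (largeTree k) (largeTree-leaf k)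

largeTree-leaf 0 = refl
largeTree-leaf 1 = refl
largeTree-leaf 2 = refl
largeTree-leaf 3 = refl
largeTree-leaf 4 = refl
largeTree-leaf 5 = refl
largeTree-leaf (suc (suc (suc (suc (suc (suc k)))))) = refl

size-largeTree : ∀ k → size (largeTree k) * 2 ≤ 12 + k
size-largeTree 0 = ≤ᵇ⇒≤ _ _ tt
size-largeTree 1 = ≤ᵇ⇒≤ _ _ tt
size-largeTree 2 = ≤ᵇ⇒≤ _ _ tt
size-largeTree 3 = ≤ᵇ⇒≤ _ _ tt
size-largeTree 4 = ≤ᵇ⇒≤ _ _ tt
size-largeTree 5 = ≤ᵇ⇒≤ _ _ tt
size-largeTree (suc (suc (suc (suc (suc (suc k)))))) = s≤s (s≤s (s≤s (s≤s (s≤s (s≤s (size-largeTree k))))))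

tree : ∀ i → Tree i
tree 0 = mkTree (nothing ∷ []) refl
tree 1 = mkTree (to 0 ∷ to 0 ∷ nothing ∷ []) refl
tree 2 = mkTree (to 0 ∷ to 0 ∷ to 0 ∷ nothing ∷ []) refl
tree 3 = mkTree (to 2 ∷ to 1 ∷ to 0 ∷ nothing ∷ []) refl
tree 4 = mkTree (to 0 ∷ to 2 ∷ to 1 ∷ to 0 ∷ nothing ∷ []) refl
tree 5 = mkTree (to 2 ∷ to 0 ∷ to 2 ∷ to 1 ∷ to 0 ∷ nothing ∷ []) refl
tree 6 = mkTree (to 3 ∷ to 2 ∷ to 1 ∷ to 0 ∷ nothing ∷ []) refl
tree 7 = mkTree (to 0 ∷ to 3 ∷ to 2 ∷ to 1 ∷ to 0 ∷ nothing ∷ []) refl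
tree 8 = mkTree (to 2 ∷ to 0 ∷ to 3 ∷ to 2 ∷ to 1 ∷ to 0 ∷ nothing ∷ []) refl
tree 9 = mkTree (to 1 ∷ to 0 ∷ to 3 ∷ to 2 ∷ to 1 ∷ to 0 ∷ nothing ∷ []) refl
tree (suc (suc (suc (suc (suc (suc (suc (suc (suc (suc k)))))))))) = largeTree k

size-tree≤-decide : ∀ k m → True (all? λ (i : Fin (suc k)) → size (tree (toℕ i)) ≤? m) → ∀ i → i ≤ k → size (tree i) ≤ m
size-tree≤-decide k m ok i i≤k = subst (λ j → size (tree j) ≤ m) (toℕ-fromℕ< (s≤s i≤k)) (toWitness ok (fromℕ< (s≤s i≤k)))

m*2≤1+n*2⇒m≤n : ∀ m n → m * 2 ≤ suc (n * 2) → m ≤ n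
m*2≤1+n*2⇒m≤n zero    n       _                 = z≤n
m*2≤1+n*2⇒m≤n (suc m) zero    (s≤s ())
m*2≤1+n*2⇒m≤n (suc m) (suc n) (s≤s (s≤s m*2≤)) = s≤s (m*2≤1+n*2⇒m≤n m n m*2≤)

size-tree≤ : ∀ {m} i → 6 ≤ m → i < m * 2 → size (tree i) ≤ m
size-tree≤ {m} i 6≤m i<m*2 with i <? 10
... | yes i<10 = ≤-trans (size-tree≤-decide 9 6 _ i (≤-pred i<10)) 6≤m
... | no  i≮10 with m≤n⇒∃[o]m+o≡n (≮⇒≥ i≮10)
...   | k , refl = m*2≤1+n*2⇒m≤n _ m (≤-trans (size-largeTree k) (s≤s i<m*2))

⌊n*2/2⌋≡n : ∀ n → ⌊ n * 2 /2⌋ ≡ n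
⌊n*2/2⌋≡n zero    = refl
⌊n*2/2⌋≡n (suc n) = cong suc (⌊n*2/2⌋≡n n)

⌊1+n*2/2⌋≡n : ∀ n → ⌊ suc (n * 2) /2⌋ ≡ n
⌊1+n*2/2⌋≡n zero    = refl
⌊1+n*2/2⌋≡n (suc n) = cong suc (⌊1+n*2/2⌋≡n n)

⌈[1+p+m*2]∸2/2⌉≡m : ∀ m {p} → p ≤ 1 → ⌈ suc (p + m * 2) ∸ 2 /2⌉ ≡ m
⌈[1+p+m*2]∸2/2⌉≡m zero    z≤n       = refl
⌈[1+p+m*2]∸2/2⌉≡m (suc m) z≤n       = cong suc (⌊n*2/2⌋≡n m)
⌈[1+p+m*2]∸2/2⌉≡m m       (s≤s z≤n) = ⌊1+n*2/2⌋≡n m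

padded : ∀ {v} → Parents v → (d q : ℕ) → Parents (v + (d * 2 + q))
padded ps d q = ps ++ᵖ matching d ++ᵖ isolated q

edgeCount-padded : ∀ {v} (ps : Parents v) d q → edgeCount (padded ps d q) ≡ edgeCount ps + d
edgeCount-padded ps d q = begin
  edgeCount (padded ps d q)                                        ≡⟨ edgeCount-++ᵖ ps _ ⟩
  edgeCount ps + edgeCount (matching d ++ᵖ isolated q)             ≡⟨ cong (edgeCount ps +_) (edgeCount-++ᵖ (matching d) _) ⟩
  edgeCount ps + (edgeCount (matching d) + edgeCount (isolated q)) ≡⟨ cong (λ x → edgeCount ps + x)
                                                                        (cong₂ _+_ (edgeCount-matching d) (edgeCount-isolated q)) ⟩
  edgeCount ps + (d + 0)                                           ≡⟨ cong (edgeCount ps +_) (+-identityʳ d) ⟩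
  edgeCount ps + d ∎
  where open ≡-Reasoning

lineEdgeCount-padded : ∀ {v} (ps : Parents v) d q → lineEdgeCount (padded ps d q) ≡ lineEdgeCount ps
lineEdgeCount-padded ps d q = begin
  lineEdgeCount (padded ps d q)                                     ≡⟨ lineEdgeCount-++ᵖ ps _ ⟩
  lineEdgeCount ps + lineEdgeCount (matching d ++ᵖ isolated q)      ≡⟨ cong (lineEdgeCount ps +_) (lineEdgeCount-++ᵖ (matching d) _) ⟩
  lineEdgeCount ps + (lineEdgeCount (matching d) + lineEdgeCount (isolated q))
                                                                    ≡⟨ cong (lineEdgeCount ps +_)
                                                                         (cong₂ _+_ (lineEdgeCount-matching d) (lineEdgeCount-isolated q)) ⟩
  lineEdgeCount ps + 0                                              ≡⟨ +-identityʳ _ ⟩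
  lineEdgeCount ps ∎
  where open ≡-Reasoning

padded-vertices : ∀ J d p → suc J + (d * 2 + (J + p)) ≡ suc (p + (J + d) * 2)
padded-vertices = solve 3 (λ J d p → con 1 :+ J :+ (d :* con 2 :+ (J :+ p)) := con 1 :+ (p :+ (J :+ d) :* con 2)) refl

realise : ∀ m p i → p ≤ 1 → size (tree i) ≤ m → Realisable (suc (p + m * 2)) i
realise m p i p≤1 size≤m =
  subst (λ n → Realisable n i) vertices (subst (Realisable _) lineEdges (Parents⇒Realisable ps edges≡))
  where
  J = size (tree i)
  d = m ∸ J
  ps = padded (parents (tree i)) d (J + p)
  J+d≡m : J + d ≡ m
  J+d≡m = m+[n∸m]≡n size≤m
  vertices : suc J + (d * 2 + (J + p)) ≡ suc (p + m * 2)
  vertices = trans (padded-vertices J d p) (cong (λ x → suc (p + x * 2)) J+d≡m)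
  edges≡ : edgeCount ps ≡ ⌈ suc J + (d * 2 + (J + p)) ∸ 2 /2⌉
  edges≡ = begin
    edgeCount ps                        ≡⟨ edgeCount-padded (parents (tree i)) d (J + p) ⟩
    edgeCount (parents (tree i)) + d    ≡⟨ cong (_+ d) (edgeCount≡size (tree i)) ⟩
    J + d                               ≡⟨ J+d≡m ⟩
    m                                   ≡⟨ sym (⌈[1+p+m*2]∸2/2⌉≡m m p≤1) ⟩
    ⌈ suc (p + m * 2) ∸ 2 /2⌉           ≡⟨ cong (λ n → ⌈ n ∸ 2 /2⌉) (sym vertices) ⟩
    ⌈ suc J + (d * 2 + (J + p)) ∸ 2 /2⌉ ∎
    where open ≡-Reasoning
  lineEdges : lineEdgeCount ps ≡ i
  lineEdges = trans (lineEdgeCount-padded (parents (tree i)) d (J + p)) (lineEdgeCount≡ (tree i))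

iStar-mono : ∀ {n j k} → j ≤ k → IStarAtLeast n k → IStarAtLeast n j
iStar-mono j≤k iStar i i≤j = iStar i (≤-trans i≤j j≤k)

iStar-small : ∀ m k → True (all? λ (i : Fin (suc k)) → size (tree (toℕ i)) ≤? m) →
  ∀ n → n ≡ suc (m * 2) ⊎ n ≡ suc (suc (m * 2)) → IStarAtLeast n k
iStar-small m k ok _ (inj₁ refl) i i≤k = realise m 0 i z≤n       (size-tree≤-decide k m ok i i≤k)
iStar-small m k ok _ (inj₂ refl) i i≤k = realise m 1 i (s≤s z≤n) (size-tree≤-decide k m ok i i≤k)

iStar-large : ∀ m p → p ≤ 1 → 6 ≤ m → IStarAtLeast (suc (p + m * 2)) (m * 2 ∸ 1)
iStar-large (suc m) p p≤1 6≤m i i≤ = realise (suc m) p i p≤1 (size-tree≤ i 6≤m (s≤s i≤))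

n%2≡1⇒n≡1+[n/2]*2 : ∀ {n} → n % 2 ≡ 1 → n ≡ suc (n / 2 * 2)
n%2≡1⇒n≡1+[n/2]*2 {n} odd = trans (m≡m%n+[m/n]*n n 2) (cong (_+ n / 2 * 2) odd)

n%2≡0⇒n≡[n/2]*2 : ∀ {n} → n % 2 ≡ 0 → n ≡ n / 2 * 2
n%2≡0⇒n≡[n/2]*2 {n} even = trans (m≡m%n+[m/n]*n n 2) (cong (_+ n / 2 * 2) even)

n%2≡0⊎n%2≡1 : ∀ n → n % 2 ≡ 0 ⊎ n % 2 ≡ 1
n%2≡0⊎n%2≡1 n with n % 2 | m%n<n n 2
... | 0 | _ = inj₁ refl
... | 1 | _ = inj₂ refl
... | suc (suc _) | s≤s (s≤s ())

iStar-odd : ∀ n → 13 ≤ n → n % 2 ≡ 1 → IStarAtLeast n (n ∸ 2)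
iStar-odd n 13≤n odd = subst (λ n → IStarAtLeast n (n ∸ 2)) (sym n≡) (iStar-large (n / 2) 0 z≤n 6≤n/2)
  where
  n≡ = n%2≡1⇒n≡1+[n/2]*2 odd
  6≤n/2 : 6 ≤ n / 2
  6≤n/2 = m*2≤1+n*2⇒m≤n 6 (n / 2) (≤-trans (m≤n⇒m≤1+n ≤-refl) (subst (13 ≤_) n≡ 13≤n))

iStar-even : ∀ n → 14 ≤ n → n % 2 ≡ 0 → IStarAtLeast n (n ∸ 3)
iStar-even n 14≤n even = subst (λ n → IStarAtLeast n (n ∸ 3)) (sym n≡) (halves (n / 2) 7≤n/2)
  where
  n≡ = n%2≡0⇒n≡[n/2]*2 even
  7≤n/2 : 7 ≤ n / 2
  7≤n/2 = m*2≤1+n*2⇒m≤n 7 (n / 2) (m≤n⇒m≤1+n (subst (14 ≤_) n≡ 14≤n))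
  halves : ∀ h → 7 ≤ h → IStarAtLeast (h * 2) (h * 2 ∸ 3)
  halves (suc m) (s≤s 6≤m) = iStar-large m 1 (s≤s z≤n) 6≤m

iStar-≥14 : ∀ n → 14 ≤ n → IStarAtLeast n (n ∸ 3)
iStar-≥14 n 14≤n with n%2≡0⊎n%2≡1 n
... | inj₁ even = iStar-even n 14≤n even
... | inj₂ odd  = iStar-mono (∸-monoʳ-≤ n (n≤1+n 2)) (iStar-odd n (<⇒≤ 14≤n) odd)

iStar-f : ∀ n → 3 ≤ n → IStarAtLeast n (f (n ∸ 2))
iStar-f 1  (s≤s ())
iStar-f 2  (s≤s (s≤s ()))
iStar-f 3  _ = iStar-small 1 0 _ 3 (inj₁ refl)
iStar-f 4  _ = iStar-small 1 0 _ 4 (inj₂ refl)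
iStar-f 5  _ = iStar-small 2 1 _ 5 (inj₁ refl)
iStar-f 6  _ = iStar-small 2 1 _ 6 (inj₂ refl)
iStar-f 7  _ = iStar-small 3 3 _ 7 (inj₁ refl)
iStar-f 8  _ = iStar-small 3 3 _ 8 (inj₂ refl)
iStar-f 9  _ = iStar-small 4 4 _ 9 (inj₁ refl)
iStar-f 10 _ = iStar-small 4 4 _ 10 (inj₂ refl)
iStar-f 11 _ = iStar-small 5 7 _ 11 (inj₁ refl)
iStar-f 12 _ = iStar-small 5 7 _ 12 (inj₂ refl)
iStar-f 13 _ = iStar-mono (n≤1+n 10) (iStar-odd 13 ≤-refl refl)
iStar-f n@(suc (suc (suc (suc (suc (suc (suc (suc (suc (suc (suc (suc (suc (suc j)))))))))))))) _ =
  iStar-≥14 n (m≤m+n 14 j)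

lemma3p11 : (∀ n → n ≡ 3 ⊎ n ≡ 4 → IStarAtLeast n 0) ×
    (∀ n → n ≡ 5 ⊎ n ≡ 6 → IStarAtLeast n 1) ×
    (∀ n → n ≡ 7 ⊎ n ≡ 8 → IStarAtLeast n 3) ×
    (∀ n → n ≡ 9 ⊎ n ≡ 10 → IStarAtLeast n 4) ×
    (∀ n → n ≡ 11 ⊎ n ≡ 12 → IStarAtLeast n 7) ×
    (∀ n → 13 ≤ n → n % 2 ≡ 1 → IStarAtLeast n (n ∸ 2)) ×
    (∀ n → 14 ≤ n → n % 2 ≡ 0 → IStarAtLeast n (n ∸ 3)) ×
    (∀ n → 3 ≤ n → IStarAtLeast n (f (n ∸ 2)))
lemma3p11 =
  iStar-small 1 0 _ , iStar-small 2 1 _ , iStar-small 3 3 _ , iStar-small 4 4 _ , iStar-small 5 7 _ ,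
  iStar-odd , iStar-even , iStar-f
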